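{- Let $k>1$ be an integer and suppose $r_0,r_1,\ldots,r_m$ are $k$-reverse multiples such that $r_j=r_{m-j}$ (as digit strings) for all $0\le j\le m$. Then the concatenation $r_0\circ r_1\circ\cdots\circ r_m$ is also a $k$-reverse multiple.
   Context: For positive integers $a_0,\ldots,a_n$, $[a_0;a_1,\ldots,a_n]$ denotes the finite simple continued fraction $a_0+1/(a_1+1/(\cdots+1/a_n))$; all finite continued fractions are assumed in canonical form (last digit at least $2$ when there are at least two digits). A $k$-reverse multiple is a continued fraction $r=[a_0;a_1,\ldots,a_n]$ with $r=k\,[a_n;a_{n-1},\ldots,a_0]$. For $c_1=[b_0;\ldots,b_n]$, $c_2=[b'_0;\ldots,b'_m]$ the concatenation is $c_1\circ c_2=[b_0;\ldots,b_n,b'_0,\ldots,b'_m]$. -}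

module Defs where

open import Data.Nat using (ℕ; zero; suc; _+_; _*_; _≤_; _<_; NonZero)
open import Data.List using (List; []; _∷_; reverse; concat; length)
open import Data.List.Relation.Unary.All using (All)
open import Data.Product using (_×_; _,_; proj₁; proj₂; Σ)
open import Data.Integer using (+_)
open import Data.Rational.Unnormalised using (ℚᵘ; mkℚᵘ; _≃_)
import Data.Rational.Unnormalised as Q
open import Relation.Binary.PropositionalEquality using (_≡_)

-- A finite simple continued fraction [a₀; a₁, …, aₙ] is represented by its
-- (nonempty) list of digits a₀ ∷ a₁ ∷ … ∷ aₙ ∷ [].
Digits : Set
Digits = List ℕ

data LastOK : Digits → Set where
  single : ∀ {a} → LastOK (a ∷ [])
  two    : ∀ {a b} → 2 ≤ b → LastOK (a ∷ b ∷ [])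
  more   : ∀ {a b c cs} → LastOK (b ∷ c ∷ cs) → LastOK (a ∷ b ∷ c ∷ cs)

Canonical : Digits → Set
Canonical ds = All (λ a → 1 ≤ a) ds × LastOK ds

-- numerator / denominator of [a₀; a₁, …, aₙ] via the standard recursion:
-- [a] = a/1 ;  [a; rest] = a + 1/[rest] = (a·p + q)/p  where [rest] = p/q.
numden : Digits → ℕ × ℕ
numden []           = 0 , 1
numden (a ∷ [])     = a , 1
numden (a ∷ b ∷ ds) with numden (b ∷ ds)
... | p , q = a * p + q , p

-- The value as an (unnormalised) rational.  For canonical digit lists the
-- denominator is ≥ 1; a zero denominator never arises for them.
value : Digits → ℚᵘ
value ds with numden ds
... | p , zero  = mkℚᵘ (+ p) 0
... | p , suc q = mkℚᵘ (+ p) q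

IsReverseMultiple : ℕ → Digits → Set
IsReverseMultiple k ds =
  Canonical ds × (value ds ≃ (mkℚᵘ (+ k) 0 Q.* value (reverse ds)))

module Submission where

-- The digits a₀,…,aₙ of a continued fraction are encoded by the
-- matrix  cf [a₀;…;aₙ] = D a₀ ⋯ D aₙ  with  D a = (a 1 ; 1 0).  Its first
-- column is (p , q) where p/q = [a₀;…;aₙ], and since every D a is symmetric,
-- the matrix of the reversed digit string is the transpose; so its first
-- column is (p , p'), the first row of cf.  Hence, writing cf = (p p' ; q _),
--   r is a k-reverse multiple  ⇔  p/q = k·p/p'  ⇔  p' = k·q,
-- i.e. ⇔ cf satisfies  Aᵀ K = K A  for  K = diag(1,k)  ("A is k-symmetric").
-- Concatenation of digit strings is multiplication of matrices, and a
-- palindromic product of k-symmetric matrices is k-symmetric, because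
-- (A₀⋯Aₘ)ᵀ K = Aₘᵀ⋯A₀ᵀ K = K A₀⋯Aₘ.  Finally canonicity of the
-- concatenation follows from that of the pieces, using that a k-reverse
-- multiple with k > 1 has at least two digits.

open import Defs
open import Data.Nat using (ℕ; zero; suc; _+_; _*_; _≤_; _<_; z≤n; s≤s; NonZero)
open import Data.Nat.Properties
  using (*-cancelˡ-≡; *-identityˡ; *-identityʳ; *-mono-≤; m≤m+n; m≤n⇒m≤1+n; <-irrefl; ≤-trans)
open import Data.Nat.Tactic.RingSolver using (solve-∀)
import Data.Integer as ℤ
import Data.Integer.Properties as ℤP
open import Data.Rational.Unnormalised using (mkℚᵘ; _≃_; *≡*)
import Data.Rational.Unnormalised as Q
open import Data.List using (List; []; _∷_; _++_; _∷ʳ_; map; reverse; concat; tabulate; foldr; length)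
open import Data.List.Properties using (unfold-reverse; map-++; map-tabulate; tabulate-cong; ++-identityʳ)
open import Data.List.Relation.Unary.All using (All; []; _∷_)
open import Data.List.Relation.Unary.All.Properties using (concat⁺; tabulate⁺)
open import Data.Fin using (Fin; opposite; inject₁; fromℕ) renaming (zero to fzero; suc to fsuc)
open import Data.Product using (_×_; _,_; proj₁)
open import Data.Empty using (⊥-elim)
open import Function using (_∘_)
open import Function.Bundles using (_⇔_; mk⇔; Equivalence)
open import Function.Construct.Composition using (_⇔-∘_)
open import Relation.Binary.PropositionalEquality
  using (_≡_; refl; sym; trans; cong; cong₂; subst; module ≡-Reasoning)
open ≡-Reasoning

record Mat₂ : Set where
  constructor mat₂
  field e₁₁ e₁₂ e₂₁ e₂₂ : ℕ
open Mat₂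

infixl 7 _⊗_
_⊗_ : Mat₂ → Mat₂ → Mat₂
mat₂ a b c d ⊗ mat₂ e f g h =
  mat₂ (a * e + b * g) (a * f + b * h) (c * e + d * g) (c * f + d * h)

_ᵀ : Mat₂ → Mat₂
mat₂ a b c d ᵀ = mat₂ a c b d

𝟙 : Mat₂
𝟙 = mat₂ 1 0 0 1

mat₂-≡ : ∀ {a b c d a' b' c' d'} → a ≡ a' → b ≡ b' → c ≡ c' → d ≡ d' →
         mat₂ a b c d ≡ mat₂ a' b' c' d'
mat₂-≡ refl refl refl refl = refl

row-col-assoc : ∀ a b e f g h i k →
  (a * e + b * g) * i + (a * f + b * h) * k ≡ a * (e * i + f * k) + b * (g * i + h * k)
row-col-assoc = solve-∀

row-col-comm : ∀ a b e g → a * e + b * g ≡ e * a + g * b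
row-col-comm = solve-∀

unit-first : ∀ a b → 1 * a + 0 * b ≡ a
unit-first = solve-∀

unit-second : ∀ a b → 0 * a + 1 * b ≡ b
unit-second = solve-∀

⊗-assoc : ∀ A B C → (A ⊗ B) ⊗ C ≡ A ⊗ (B ⊗ C)
⊗-assoc (mat₂ a b c d) (mat₂ e f g h) (mat₂ i j k l) =
  mat₂-≡ (row-col-assoc a b e f g h i k) (row-col-assoc a b e f g h j l)
         (row-col-assoc c d e f g h i k) (row-col-assoc c d e f g h j l)

⊗-identityˡ : ∀ A → 𝟙 ⊗ A ≡ A
⊗-identityˡ (mat₂ a b c d) =
  mat₂-≡ (unit-first a c) (unit-first b d) (unit-second a c) (unit-second b d)

⊗-identityʳ : ∀ A → A ⊗ 𝟙 ≡ A
⊗-identityʳ (mat₂ a b c d) =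
  mat₂-≡ (trans (row-col-comm a b 1 0) (unit-first a b))
         (trans (row-col-comm a b 0 1) (unit-second a b))
         (trans (row-col-comm c d 1 0) (unit-first c d))
         (trans (row-col-comm c d 0 1) (unit-second c d))

ᵀ-⊗ : ∀ A B → (A ⊗ B) ᵀ ≡ B ᵀ ⊗ A ᵀ
ᵀ-⊗ (mat₂ a b c d) (mat₂ e f g h) =
  mat₂-≡ (row-col-comm a b e g) (row-col-comm c d e g)
         (row-col-comm a b f h) (row-col-comm c d f h)

prod : List Mat₂ → Mat₂
prod = foldr _⊗_ 𝟙

prod-++ : ∀ As Bs → prod (As ++ Bs) ≡ prod As ⊗ prod Bs
prod-++ []       Bs = sym (⊗-identityˡ _)
prod-++ (A ∷ As) Bs = trans (cong (A ⊗_) (prod-++ As Bs)) (sym (⊗-assoc A _ _))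

prod-ᵀ : ∀ As → prod As ᵀ ≡ prod (map _ᵀ (reverse As))
prod-ᵀ []       = refl
prod-ᵀ (A ∷ As) = begin
  (A ⊗ prod As) ᵀ                            ≡⟨ ᵀ-⊗ A (prod As) ⟩
  prod As ᵀ ⊗ A ᵀ                            ≡⟨ cong₂ _⊗_ (prod-ᵀ As) (sym (⊗-identityʳ (A ᵀ))) ⟩
  prod (map _ᵀ (reverse As)) ⊗ prod (A ᵀ ∷ []) ≡⟨ sym (prod-++ (map _ᵀ (reverse As)) _) ⟩
  prod (map _ᵀ (reverse As) ++ map _ᵀ (A ∷ [])) ≡⟨ cong prod (sym (map-++ _ᵀ (reverse As) _)) ⟩
  prod (map _ᵀ (reverse As ∷ʳ A))            ≡⟨ cong (prod ∘ map _ᵀ) (sym (unfold-reverse A As)) ⟩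
  prod (map _ᵀ (reverse (A ∷ As)))           ∎

module _ (k : ℕ) where

  K : Mat₂
  K = mat₂ 1 0 0 k

  -- Entrywise, Aᵀ K = K A says exactly that the upper-right entry is k times
  -- the lower-left one.
  KSymmetric : Mat₂ → Set
  KSymmetric A = e₁₂ A ≡ k * e₂₁ A

  KSymmetric⇒intertwines : ∀ A → KSymmetric A → A ᵀ ⊗ K ≡ K ⊗ A
  KSymmetric⇒intertwines (mat₂ a .(k * c) c d) refl =
    mat₂-≡ (entry₁₁ a c) (entry₁₂ k a c d) (entry₂₁ k a c d) (entry₂₂ k c d)
    where
    entry₁₁ : ∀ a c → a * 1 + c * 0 ≡ 1 * a + 0 * c
    entry₁₁ = solve-∀
    entry₁₂ : ∀ k a c d → a * 0 + c * k ≡ 1 * (k * c) + 0 * d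
    entry₁₂ = solve-∀
    entry₂₁ : ∀ k a c d → k * c * 1 + d * 0 ≡ 0 * a + k * c
    entry₂₁ = solve-∀
    entry₂₂ : ∀ k c d → k * c * 0 + d * k ≡ 0 * (k * c) + k * d
    entry₂₂ = solve-∀

  intertwines⇒KSymmetric : ∀ A → A ᵀ ⊗ K ≡ K ⊗ A → KSymmetric A
  intertwines⇒KSymmetric (mat₂ a b c d) eq =
    trans (sym (unit-first b d)) (trans (sym (cong e₁₂ eq)) (upper-right k a c))
    where
    upper-right : ∀ k a c → a * 0 + c * k ≡ k * c
    upper-right = solve-∀

  prod-intertwines : ∀ Bs → All KSymmetric Bs → prod (map _ᵀ Bs) ⊗ K ≡ K ⊗ prod Bs
  prod-intertwines []       []         = trans (⊗-identityˡ K) (sym (⊗-identityʳ K))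
  prod-intertwines (B ∷ Bs) (kB ∷ kBs) = begin
    B ᵀ ⊗ prod (map _ᵀ Bs) ⊗ K   ≡⟨ ⊗-assoc (B ᵀ) _ _ ⟩
    B ᵀ ⊗ (prod (map _ᵀ Bs) ⊗ K) ≡⟨ cong (B ᵀ ⊗_) (prod-intertwines Bs kBs) ⟩
    B ᵀ ⊗ (K ⊗ prod Bs)          ≡⟨ sym (⊗-assoc (B ᵀ) _ _) ⟩
    B ᵀ ⊗ K ⊗ prod Bs            ≡⟨ cong (_⊗ prod Bs) (KSymmetric⇒intertwines B kB) ⟩
    K ⊗ B ⊗ prod Bs              ≡⟨ ⊗-assoc K B _ ⟩
    K ⊗ (B ⊗ prod Bs)            ∎

  palindromic-prod : ∀ As → All KSymmetric As → reverse As ≡ As → KSymmetric (prod As)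
  palindromic-prod As kAs palindrome = intertwines⇒KSymmetric (prod As) (begin
    prod As ᵀ ⊗ K                  ≡⟨ cong (_⊗ K) (prod-ᵀ As) ⟩
    prod (map _ᵀ (reverse As)) ⊗ K ≡⟨ cong (λ Bs → prod (map _ᵀ Bs) ⊗ K) palindrome ⟩
    prod (map _ᵀ As) ⊗ K           ≡⟨ prod-intertwines As kAs ⟩
    K ⊗ prod As                    ∎)

opposite-inject₁ : ∀ {n} (i : Fin n) → opposite (inject₁ i) ≡ fsuc (opposite i)
opposite-inject₁ {suc n} fzero    = refl
opposite-inject₁ {suc n} (fsuc i) = cong inject₁ (opposite-inject₁ i)

opposite-fromℕ : ∀ n → opposite (fromℕ n) ≡ fzero
opposite-fromℕ zero    = refl
opposite-fromℕ (suc n) = cong inject₁ (opposite-fromℕ n)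

tabulate-∷ʳ : ∀ {A : Set} n (f : Fin (suc n) → A) →
              tabulate f ≡ tabulate (f ∘ inject₁) ∷ʳ f (fromℕ n)
tabulate-∷ʳ zero    f = refl
tabulate-∷ʳ (suc n) f = cong (f fzero ∷_) (tabulate-∷ʳ n (f ∘ fsuc))

reverse-tabulate : ∀ {A : Set} n (f : Fin n → A) → reverse (tabulate f) ≡ tabulate (f ∘ opposite)
reverse-tabulate zero    f = refl
reverse-tabulate (suc n) f = begin
  reverse (f fzero ∷ tabulate (f ∘ fsuc))      ≡⟨ unfold-reverse (f fzero) (tabulate (f ∘ fsuc)) ⟩
  reverse (tabulate (f ∘ fsuc)) ∷ʳ f fzero     ≡⟨ cong (_∷ʳ f fzero) (reverse-tabulate n (f ∘ fsuc)) ⟩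
  tabulate (f ∘ fsuc ∘ opposite) ∷ʳ f fzero    ≡⟨ cong₂ _∷ʳ_ (tabulate-cong (cong f ∘ sym ∘ opposite-inject₁))
                                                              (cong f (sym (opposite-fromℕ n))) ⟩
  tabulate (f ∘ opposite ∘ inject₁) ∷ʳ f (opposite (fromℕ n)) ≡⟨ sym (tabulate-∷ʳ n (f ∘ opposite)) ⟩
  tabulate (f ∘ opposite)                      ∎

D : ℕ → Mat₂
D a = mat₂ a 1 1 0

cf : Digits → Mat₂
cf []       = 𝟙
cf (a ∷ as) = D a ⊗ cf as

cf-++ : ∀ as bs → cf (as ++ bs) ≡ cf as ⊗ cf bs
cf-++ []       bs = sym (⊗-identityˡ _)
cf-++ (a ∷ as) bs = trans (cong (D a ⊗_) (cf-++ as bs)) (sym (⊗-assoc (D a) _ _))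

cf-concat : ∀ ass → cf (concat ass) ≡ prod (map cf ass)
cf-concat []         = refl
cf-concat (as ∷ ass) = trans (cf-++ as (concat ass)) (cong (cf as ⊗_) (cf-concat ass))

-- Each D a is symmetric, so reversing the digits transposes the matrix.
cf-reverse : ∀ as → cf (reverse as) ≡ cf as ᵀ
cf-reverse []       = refl
cf-reverse (a ∷ as) = begin
  cf (reverse (a ∷ as))         ≡⟨ cong cf (unfold-reverse a as) ⟩
  cf (reverse as ++ a ∷ [])     ≡⟨ cf-++ (reverse as) (a ∷ []) ⟩
  cf (reverse as) ⊗ (D a ⊗ 𝟙)   ≡⟨ cong₂ _⊗_ (cf-reverse as) (⊗-identityʳ (D a)) ⟩
  cf as ᵀ ⊗ D a ᵀ               ≡⟨ sym (ᵀ-⊗ (D a) (cf as)) ⟩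
  (D a ⊗ cf as) ᵀ               ∎

firstColumn firstRow : Mat₂ → ℕ × ℕ
firstColumn A = e₁₁ A , e₂₁ A
firstRow    A = e₁₁ A , e₁₂ A

numden-cf : ∀ a as → numden (a ∷ as) ≡ firstColumn (cf (a ∷ as))
numden-cf a []       = cong (_, 1) (sym (trans (row-col-comm a 1 1 0) (unit-first a 1)))
numden-cf a (b ∷ bs) =
  trans (cong (λ (p , q) → a * p + q , p) (numden-cf b bs))
        (cong₂ _,_ (cong (a * p +_) (sym (*-identityˡ q))) (sym (unit-first p q)))
  where
  p q : ℕ
  p = e₁₁ (cf (b ∷ bs))
  q = e₂₁ (cf (b ∷ bs))

numden-cf-∷ʳ : ∀ as a → numden (as ∷ʳ a) ≡ firstColumn (cf (as ∷ʳ a))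
numden-cf-∷ʳ []       a = numden-cf a []
numden-cf-∷ʳ (b ∷ bs) a = numden-cf b (bs ∷ʳ a)

numden-reverse-cf : ∀ a as → numden (reverse (a ∷ as)) ≡ firstRow (cf (a ∷ as))
numden-reverse-cf a as = begin
  numden (reverse (a ∷ as))                ≡⟨ cong numden (unfold-reverse a as) ⟩
  numden (reverse as ∷ʳ a)                 ≡⟨ numden-cf-∷ʳ (reverse as) a ⟩
  firstColumn (cf (reverse as ∷ʳ a))       ≡⟨ cong (firstColumn ∘ cf) (sym (unfold-reverse a as)) ⟩
  firstColumn (cf (reverse (a ∷ as)))      ≡⟨ cong firstColumn (cf-reverse (a ∷ as)) ⟩
  firstRow (cf (a ∷ as))                   ∎

-- For positive digits the entries of the matrix that carry numerators and
-- denominators are positive.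
PositiveEntries : Mat₂ → Set
PositiveEntries A = 1 ≤ e₁₁ A × 1 ≤ e₁₂ A × 1 ≤ e₂₁ A

-- Each relevant entry of a product is x·y + z with x, y positive.
positive-dot : ∀ {x y} z → 1 ≤ x → 1 ≤ y → 1 ≤ x * y + z
positive-dot {x} {y} z 1≤x 1≤y = ≤-trans (*-mono-≤ 1≤x 1≤y) (m≤m+n (x * y) z)

cf-positive : ∀ a as → All (1 ≤_) (a ∷ as) → PositiveEntries (cf (a ∷ as))
cf-positive a []       (1≤a ∷ []) =
  subst PositiveEntries (sym (⊗-identityʳ (D a))) (1≤a , s≤s z≤n , s≤s z≤n)
cf-positive a (b ∷ bs) (1≤a ∷ 1≤bs) with cf-positive b bs 1≤bs
... | 1≤p , 1≤p' , 1≤q =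
  positive-dot _ 1≤a 1≤p , positive-dot _ 1≤a 1≤p' , positive-dot {x = 1} _ (s≤s z≤n) 1≤p

pos-cross : ∀ k n b c → (ℤ.+ n ℤ.* ℤ.+ b ≡ (ℤ.+ k ℤ.* ℤ.+ n) ℤ.* ℤ.+ c) ⇔ (n * b ≡ k * n * c)
pos-cross k n b c = mk⇔ to from
  where
  rhs : (ℤ.+ k ℤ.* ℤ.+ n) ℤ.* ℤ.+ c ≡ ℤ.+ (k * n * c)
  rhs = trans (cong (ℤ._* ℤ.+ c) (sym (ℤP.pos-* k n))) (sym (ℤP.pos-* (k * n) c))
  to : ℤ.+ n ℤ.* ℤ.+ b ≡ (ℤ.+ k ℤ.* ℤ.+ n) ℤ.* ℤ.+ c → n * b ≡ k * n * c
  to eq = ℤP.+-injective (trans (ℤP.pos-* n b) (trans eq rhs))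
  from : n * b ≡ k * n * c → ℤ.+ n ℤ.* ℤ.+ b ≡ (ℤ.+ k ℤ.* ℤ.+ n) ℤ.* ℤ.+ c
  from eq = trans (sym (ℤP.pos-* n b)) (trans (cong ℤ.+_ eq) (sym rhs))

cancel-factor : ∀ k n b c → .{{NonZero n}} → (n * b ≡ k * n * c) ⇔ (b ≡ k * c)
cancel-factor k n b c = mk⇔
  (λ eq → *-cancelˡ-≡ b (k * c) n (trans eq (reassoc k n c)))
  (λ eq → trans (cong (n *_) eq) (sym (reassoc k n c)))
  where
  reassoc : ∀ k n c → k * n * c ≡ n * (k * c)
  reassoc = solve-∀

-- The rational identity  p/C = k·(p/B)  with p ≥ 1 means  B = k·C.  (The
-- denominator of the product k/1 · p/B is computed as 1·B.)
ratio-criterion : ∀ k p qb qc →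
  (mkℚᵘ (ℤ.+ suc p) qc ≃ mkℚᵘ (ℤ.+ k) 0 Q.* mkℚᵘ (ℤ.+ suc p) qb) ⇔ (suc qb ≡ k * suc qc)
ratio-criterion k p qb qc =
  mk⇔ (trans (sym (*-identityˡ _))) (trans (*-identityˡ _))
  ⇔-∘ (cancel-factor k (suc p) (1 * suc qb) (suc qc)
  ⇔-∘ (pos-cross k (suc p) (1 * suc qb) (suc qc)
  ⇔-∘ mk⇔ (λ { (*≡* eq) → eq }) *≡*))

value-from-numden : ∀ ds p q → numden ds ≡ (p , suc q) → value ds ≡ mkℚᵘ (ℤ.+ p) q
value-from-numden ds p q eq rewrite eq = refl

reverse-multiple-criterion : ∀ k ds A → PositiveEntries A →
  numden ds ≡ firstColumn A → numden (reverse ds) ≡ firstRow A →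
  (value ds ≃ mkℚᵘ (ℤ.+ k) 0 Q.* value (reverse ds)) ⇔ KSymmetric k A
reverse-multiple-criterion k ds (mat₂ (suc p) (suc qb) (suc qc) _) _ eq eqʳ
  rewrite value-from-numden ds _ _ eq | value-from-numden (reverse ds) _ _ eqʳ =
  ratio-criterion k p qb qc

reverse-multiple⇔KSymmetric : ∀ k ds → Canonical ds →
  (value ds ≃ mkℚᵘ (ℤ.+ k) 0 Q.* value (reverse ds)) ⇔ KSymmetric k (cf ds)
reverse-multiple⇔KSymmetric k []       (_ , ())
reverse-multiple⇔KSymmetric k (a ∷ as) (positive , _) =
  reverse-multiple-criterion k (a ∷ as) (cf (a ∷ as))
    (cf-positive a as positive) (numden-cf a as) (numden-reverse-cf a as)

reverse-multiple⇒KSymmetric : ∀ k ds → IsReverseMultiple k ds → KSymmetric k (cf ds)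
reverse-multiple⇒KSymmetric k ds (canonical , rm) =
  Equivalence.to (reverse-multiple⇔KSymmetric k ds canonical) rm

-- Canonicity of concatenations.  "ds ends canonically and has at least two
-- digits" is preserved by prepending arbitrary digits, unlike LastOK alone.
LongLastOK : Digits → Set
LongLastOK ds = LastOK ds × 2 ≤ length ds

LongLastOK-++ : ∀ as ds → LongLastOK ds → LongLastOK (as ++ ds)
LongLastOK-++ []       ds long = long
LongLastOK-++ (a ∷ as) ds long with as ++ ds | LongLastOK-++ as ds long
... | _ ∷ []     | _ , s≤s ()
... | b ∷ c ∷ cs | last , 2≤len = more last , m≤n⇒m≤1+n 2≤len

LongLastOK-concat : ∀ m (r : Fin (suc m) → Digits) → (∀ j → LongLastOK (r j)) →
                    LongLastOK (concat (tabulate r))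
LongLastOK-concat zero    r long rewrite ++-identityʳ (r fzero) = long fzero
LongLastOK-concat (suc m) r long =
  LongLastOK-++ (r fzero) _ (LongLastOK-concat m (r ∘ fsuc) (long ∘ fsuc))

-- For k > 1 a k-reverse multiple has at least two digits: [a] = k·[a] is
-- impossible, as its matrix D a has off-diagonal entries 1 ≠ k·1.
reverse-multiple-LongLastOK : ∀ k → 1 < k → ∀ ds → IsReverseMultiple k ds → LongLastOK ds
reverse-multiple-LongLastOK k 1<k (a ∷ []) rm =
  ⊥-elim (<-irrefl (trans 1≡k·1 (*-identityʳ k)) 1<k)
  where
  1≡k·1 : 1 ≡ k * 1
  1≡k·1 = subst (KSymmetric k) (⊗-identityʳ (D a)) (reverse-multiple⇒KSymmetric k (a ∷ []) rm)
reverse-multiple-LongLastOK k 1<k (a ∷ b ∷ ds) ((_ , last) , _) = last , s≤s (s≤s z≤n)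

corollary25 : (k : ℕ) → 1 < k → (m : ℕ) → (r : Fin (suc m) → Digits) →
    ((j : Fin (suc m)) → IsReverseMultiple k (r j)) →
    ((j : Fin (suc m)) → r j ≡ r (opposite j)) →
    IsReverseMultiple k (concat (tabulate r))
corollary25 k 1<k m r rm palindrome =
  canonical , Equivalence.from (reverse-multiple⇔KSymmetric k (concat (tabulate r)) canonical) kSym
  where
  canonical : Canonical (concat (tabulate r))
  canonical = concat⁺ (tabulate⁺ (proj₁ ∘ proj₁ ∘ rm))
            , proj₁ (LongLastOK-concat m r (λ j → reverse-multiple-LongLastOK k 1<k (r j) (rm j)))
  matrices-palindromic : reverse (tabulate (cf ∘ r)) ≡ tabulate (cf ∘ r)
  matrices-palindromic = trans (reverse-tabulate (suc m) (cf ∘ r))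
                               (tabulate-cong (cong cf ∘ sym ∘ palindrome))
  kSym : KSymmetric k (cf (concat (tabulate r)))
  kSym = subst (KSymmetric k) (sym (trans (cf-concat (tabulate r)) (cong prod (map-tabulate r cf))))
           (palindromic-prod k (tabulate (cf ∘ r))
              (tabulate⁺ {f = cf ∘ r} (λ j → reverse-multiple⇒KSymmetric k (r j) (rm j))) matrices-palindromic)
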